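{- Let $G,H$ be graphs, connected or otherwise. Then $$\iota(G+H)=\begin{cases}\dfrac{\widetilde\iota(G)\widetilde\iota(H)-1}{\widetilde\iota(G)+\widetilde\iota(H)-2}, & \widetilde\iota(G),\widetilde\iota(H)<\infty \text{ and } \widetilde\iota(G)+\widetilde\iota(H)\ne 2,\\ 1, & \widetilde\iota(G)=\widetilde\iota(H)=1,\\ \infty, & \widetilde\iota(G)+\widetilde\iota(H)=2,\ (\widetilde\iota(G),\widetilde\iota(H))\ne(1,1),\\ \widetilde\iota(H), & \widetilde\iota(G)=\infty,\ \widetilde\iota(H)<\infty,\\ \widetilde\iota(G), & \widetilde\iota(H)=\infty,\ \widetilde\iota(G)<\infty,\\ \infty, & \widetilde\iota(G)=\widetilde\iota(H)=\infty.\end{cases}$$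
   Context: All graphs are finite, simple, undirected. For a connected graph $G$ with vertices $v_1,\dots,v_n$, $D=(d(v_i,v_j))_{i,j}$ is its shortest-path distance matrix and $\vec 1$ the all-ones vector. For a symmetric matrix $M\in\mathbb{R}^{n\times n}$, define an index $\iota_M$ as follows: if $M\vec x=\vec 1$ has no solution, or has a solution $\vec x$ with $\vec 1^\top\vec x\ne0$, then there is a unique real number $\iota_M$ such that $M\vec x=\iota_M\vec 1$ for some $\vec x$ with $\vec 1^\top\vec x=1$; otherwise (every solution of $M\vec x=\vec 1$ has coordinate sum zero) $\iota_M:=\infty$. The curvature index of a connected graph is $\iota(G):=\iota_{D(G)}$. For a (possibly disconnected) graph $G$ on $n$ vertices, $\widetilde D(G)\in\mathbb{R}^{n\times n}$ is the principal submatrix indexed by $V(G)$ of the distance matrix of the cone $G+\mathsf K_1$ (so its $(u,v)$ entry is $\min\{d_G(u,v),2\}$, with $d_G(u,v)=\infty$ for vertices in different components), and the modified curvature index is $\widetilde\iota(G):=\iota_{\widetilde D(G)}$. The join $G+H$ is the graph obtained from the disjoint union of $G$ and $H$ by connecting every vertex of $G$ to every vertex of $H$. -}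

module Defs where

open import Data.Nat as ℕ using (ℕ; zero; suc; _⊓_)
open import Data.Integer as ℤ using (+_)
open import Data.Rational as ℚ using (ℚ; 0ℚ; 1ℚ; _÷_; ≢-nonZero)
open import Data.Bool using (Bool; true; false; _∧_; _∨_; if_then_else_)
open import Data.Fin as Fin using (Fin; zero; suc; splitAt)
open import Data.Maybe using (Maybe; just; nothing; maybe)
open import Data.Sum using (_⊎_; inj₁; inj₂)
open import Data.Product using (_×_; _,_; ∃)
open import Relation.Nullary using (¬_; yes; no; does)
open import Relation.Binary.PropositionalEquality using (_≡_; _≢_; refl)

record Graph (n : ℕ) : Set where
  field
    adj    : Fin n → Fin n → Bool
    adjSym : ∀ u v → adj u v ≡ adj v u
    irrefl : ∀ u → adj u u ≡ false
open Graph public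

joinAdj : ∀ {n m} → Graph n → Graph m → Fin (n ℕ.+ m) → Fin (n ℕ.+ m) → Bool
joinAdj {n} G H u v with splitAt n u | splitAt n v
... | inj₁ a | inj₁ b = adj G a b
... | inj₂ a | inj₂ b = adj H a b
... | inj₁ _ | inj₂ _ = true
... | inj₂ _ | inj₁ _ = true

joinSym : ∀ {n m} (G : Graph n) (H : Graph m) u v → joinAdj G H u v ≡ joinAdj G H v u
joinSym {n} G H u v with splitAt n u | splitAt n v
... | inj₁ a | inj₁ b = adjSym G a b
... | inj₂ a | inj₂ b = adjSym H a b
... | inj₁ _ | inj₂ _ = refl
... | inj₂ _ | inj₁ _ = refl

joinIrrefl : ∀ {n m} (G : Graph n) (H : Graph m) u → joinAdj G H u u ≡ false
joinIrrefl {n} G H u with splitAt n u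
... | inj₁ a = irrefl G a
... | inj₂ a = irrefl H a

_⊹_ : ∀ {n m} → Graph n → Graph m → Graph (n ℕ.+ m)
G ⊹ H = record { adj = joinAdj G H ; adjSym = joinSym G H ; irrefl = joinIrrefl G H }

anyFin : ∀ {n} → (Fin n → Bool) → Bool
anyFin {zero}  p = false
anyFin {suc n} p = p zero ∨ anyFin (λ i → p (suc i))

reach : ∀ {n} → Graph n → ℕ → Fin n → Fin n → Bool
reach G zero    u v = does (u Fin.≟ v)
reach G (suc k) u v = reach G k u v ∨ anyFin (λ w → reach G k u w ∧ adj G w v)

search : (ℕ → Bool) → ℕ → Maybe ℕ
search p zero = nothing
search p (suc b) with search p b
... | just k  = just k
... | nothing = if p b then just b else nothing

-- d_G(u,v); nothing encodes d_G(u,v) = ∞ (different components).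
-- (A shortest path has length < n, so searching k < n suffices.)
dist : ∀ {n} → Graph n → Fin n → Fin n → Maybe ℕ
dist {n} G u v = search (λ k → reach G k u v) n

toℚ : ℕ → ℚ
toℚ k = + k ℚ./ 1

-- Distance matrix D(G) (only used for connected G; for a disconnected
-- graph the meaningless infinite entries are filled with 0).
D : ∀ {n} → Graph n → Fin n → Fin n → ℚ
D G u v = maybe toℚ 0ℚ (dist G u v)

D̃ : ∀ {n} → Graph n → Fin n → Fin n → ℚ
D̃ G u v = maybe (λ k → toℚ (k ⊓ 2)) (toℚ 2) (dist G u v)

Σ : ∀ {n} → (Fin n → ℚ) → ℚ
Σ {zero}  f = 0ℚ
Σ {suc n} f = f zero ℚ.+ Σ (λ i → f (suc i))

Matrix : ℕ → Set
Matrix n = Fin n → Fin n → ℚ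

_·_≡const_ : ∀ {n} → Matrix n → (Fin n → ℚ) → ℚ → Set
M · x ≡const c = ∀ i → Σ (λ j → M i j ℚ.* x j) ≡ c

data Ext : Set where
  fin : ℚ → Ext
  ∞   : Ext

HasIndex : ∀ {n} → Matrix n → Ext → Set
HasIndex {n} M ∞ =
  ∃ (λ (x : Fin n → ℚ) → M · x ≡const 1ℚ) ×
  (∀ (x : Fin n → ℚ) → M · x ≡const 1ℚ → Σ x ≡ 0ℚ)
HasIndex {n} M (fin t) =
  (¬ ∃ (λ (x : Fin n → ℚ) → M · x ≡const 1ℚ)
    ⊎ ∃ (λ (x : Fin n → ℚ) → M · x ≡const 1ℚ × Σ x ≢ 0ℚ)) ×
  ∃ (λ (x : Fin n → ℚ) → M · x ≡const t × Σ x ≡ 1ℚ)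

ιIs : ∀ {n} → Graph n → Ext → Set
ιIs G t = HasIndex (D G) t

ι̃Is : ∀ {n} → Graph n → Ext → Set
ι̃Is G t = HasIndex (D̃ G) t

finCase : ℚ → ℚ → Ext
finCase a b with (a ℚ.+ b ℚ.- toℚ 2) ℚ.≟ 0ℚ
... | no ne = fin (_÷_ (a ℚ.* b ℚ.- 1ℚ) (a ℚ.+ b ℚ.- toℚ 2) {{≢-nonZero ne}})
... | yes _ with a ℚ.≟ 1ℚ | b ℚ.≟ 1ℚ
...   | yes _ | yes _ = fin 1ℚ
...   | _     | _     = ∞

joinFormula : Ext → Ext → Ext
joinFormula (fin a) (fin b) = finCase a b
joinFormula ∞       (fin b) = fin b
joinFormula (fin a) ∞       = fin a
joinFormula ∞       ∞       = ∞

-- For a symmetric matrix M, the pairs (Σ x, c) with M x = c·1 form a subspace of ℚ², and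
-- the identity yᵀ M x = xᵀ M y shows that any two of them are proportional.  So ι_M = t
-- says exactly that this subspace is the line c = t σ, and ι_M = ∞ that it is the line
-- σ = 0.  In G + H every vertex of H is a common neighbour of any two vertices of G, so
-- D(G + H) = [[D̃(G), J], [J, D̃(H)]] with J all-ones.  Splitting a solution as x = (y, w),
-- D(G + H) x = c·1 iff D̃(G) y = (c - Σ w)·1 and D̃(H) w = (c - Σ y)·1; hence the line of
-- G + H arises from the lines of G and H by eliminating Σ y and Σ w from two linear
-- equations, and solving them case by case gives the formula.
module Submission where

open import Defs
open import Level using (0ℓ)
open import Algebra.Bundles using (CommutativeRing)
open import Data.Nat as ℕ using (ℕ; zero; suc; _<_; z≤n; s≤s; _⊓_)
import Data.Nat.Properties as ℕP
open import Data.Rational using (ℚ; 0ℚ; 1ℚ; _+_; _*_; _-_; -_; 1/_; _÷_; NonZero; ≢-nonZero)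
open import Data.Rational.Properties as ℚP using (_≟_)
open import Data.Rational.Solver using (module +-*-Solver)
open import Data.Fin as Fin using (Fin; zero; suc; _↑ˡ_; _↑ʳ_; splitAt; join)
open import Data.Fin.Properties using (splitAt-↑ˡ; splitAt-↑ʳ; join-splitAt; ↑ˡ-injective; ↑ʳ-injective; punchOut-injective; toℕ<n)
open import Data.Vec.Functional using (_++_)
open import Data.Vec.Functional.Properties using (lookup-++ˡ; lookup-++ʳ)
open import Data.Bool using (Bool; true; false; _∧_; _∨_)
open import Data.Bool.Properties using (∨-zeroʳ)
open import Data.Maybe using (just; nothing; maybe)
open import Data.Sum using (_⊎_; inj₁; inj₂; [_,_])
open import Data.Product using (_×_; _,_; ∃; ∃₂)
open import Data.Empty using (⊥-elim)
open import Function using (_∘_; Injective)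
open import Function.Bundles using (_⇔_; mk⇔; Equivalence)
open import Function.Construct.Composition using (_⇔-∘_)
open import Function.Construct.Symmetry using (⇔-sym)
open import Relation.Nullary using (¬_; yes; no; does)
open import Relation.Nullary.Decidable using (dec-true; dec-false)
open import Relation.Binary.Core using (Rel)
open import Relation.Binary.PropositionalEquality
open ≡-Reasoning
open +-*-Solver using (solve; _:+_; _:*_; _:-_; :-_; _:=_; con)
open import Algebra.Properties.Semiring.Sum (CommutativeRing.semiring ℚP.+-*-commutativeRing)
  using (sum; ∑-comm; *-distribˡ-sum)

1≢0 : 1ℚ ≢ 0ℚ
1≢0 ()

p+q≡r⇒p≡r-q : ∀ {p q r} → p + q ≡ r → p ≡ r - q
p+q≡r⇒p≡r-q {p} {q} refl = solve 2 (λ p q → p := (p :+ q) :- q) refl p q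

p-q+q≡p : ∀ p q → (p - q) + q ≡ p
p-q+q≡p = solve 2 (λ p q → (p :- q) :+ q := p) refl

p≡q⇒p-q≡0 : ∀ {p q} → p ≡ q → p - q ≡ 0ℚ
p≡q⇒p-q≡0 {p} refl = ℚP.+-inverseʳ p

p-q≡0⇒p≡q : ∀ {p q} → p - q ≡ 0ℚ → p ≡ q
p-q≡0⇒p≡q {p} {q} p-q≡0 = begin
  p            ≡⟨ p-q+q≡p p q ⟨
  (p - q) + q  ≡⟨ cong (_+ q) p-q≡0 ⟩
  0ℚ + q       ≡⟨ ℚP.+-identityˡ q ⟩
  q            ∎

p*q≡r⇒p≡r÷q : ∀ {p r} q .{{_ : NonZero q}} → p * q ≡ r → p ≡ r ÷ q
p*q≡r⇒p≡r÷q {p} q refl = begin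
  p                 ≡⟨ ℚP.*-identityʳ p ⟨
  p * 1ℚ            ≡⟨ cong (p *_) (ℚP.*-inverseʳ q) ⟨
  p * (q * 1/ q)    ≡⟨ ℚP.*-assoc p q (1/ q) ⟨
  (p * q) * 1/ q    ∎

q*[p÷q]≡p : ∀ p q .{{_ : NonZero q}} → q * (p ÷ q) ≡ p
q*[p÷q]≡p p q = begin
  q * (p * 1/ q)  ≡⟨ solve 3 (λ p q r → q :* (p :* r) := p :* (q :* r)) refl p q (1/ q) ⟩
  p * (q * 1/ q)  ≡⟨ cong (p *_) (ℚP.*-inverseʳ q) ⟩
  p * 1ℚ          ≡⟨ ℚP.*-identityʳ p ⟩
  p               ∎

Σ≡sum : ∀ {n} (f : Fin n → ℚ) → Σ f ≡ sum f
Σ≡sum {zero}  f = refl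
Σ≡sum {suc n} f = cong (f zero +_) (Σ≡sum (f ∘ suc))

Σ-cong : ∀ {n} {f g : Fin n → ℚ} → (∀ i → f i ≡ g i) → Σ f ≡ Σ g
Σ-cong {zero}  f≗g = refl
Σ-cong {suc n} f≗g = cong₂ _+_ (f≗g zero) (Σ-cong (f≗g ∘ suc))

Σ-*ˡ : ∀ {n} k (f : Fin n → ℚ) → Σ (λ i → k * f i) ≡ k * Σ f
Σ-*ˡ k f = begin
  Σ (λ i → k * f i)   ≡⟨ Σ≡sum (λ i → k * f i) ⟩
  sum (λ i → k * f i) ≡⟨ *-distribˡ-sum k f ⟨
  k * sum f           ≡⟨ cong (k *_) (Σ≡sum f) ⟨
  k * Σ f             ∎

Σ-comm : ∀ {m n} (F : Fin m → Fin n → ℚ) → Σ (λ i → Σ (F i)) ≡ Σ (λ j → Σ (λ i → F i j))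
Σ-comm F = begin
  Σ (λ i → Σ (F i))             ≡⟨ trans (Σ-cong (Σ≡sum ∘ F)) (Σ≡sum (λ i → sum (F i))) ⟩
  sum (λ i → sum (F i))         ≡⟨ ∑-comm F ⟩
  sum (λ j → sum (λ i → F i j)) ≡⟨ trans (Σ-cong (λ j → Σ≡sum (λ i → F i j))) (Σ≡sum (λ j → sum (λ i → F i j))) ⟨
  Σ (λ j → Σ (λ i → F i j))     ∎

Σ-split : ∀ p q (f : Fin (p ℕ.+ q) → ℚ) → Σ f ≡ Σ (λ i → f (i ↑ˡ q)) + Σ (λ j → f (p ↑ʳ j))
Σ-split zero    q f = sym (ℚP.+-identityˡ (Σ f))
Σ-split (suc p) q f = trans (cong (f zero +_) (Σ-split p q (f ∘ suc))) (sym (ℚP.+-assoc (f zero) _ _))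

↑ˡ-↑ʳ-elim : ∀ {p q} (P : Fin (p ℕ.+ q) → Set) → (∀ i → P (i ↑ˡ q)) → (∀ j → P (p ↑ʳ j)) → ∀ u → P u
↑ˡ-↑ʳ-elim {p} {q} P left right u =
  subst P (join-splitAt p q u) ([_,_] {C = P ∘ join p q} left right (splitAt p u))

Solvable : ∀ {n} → Matrix n → Rel ℚ 0ℓ
Solvable M σ c = ∃ λ x → M · x ≡const c × Σ x ≡ σ

OnLine : Ext → Rel ℚ 0ℓ
OnLine (fin t) σ c = c ≡ t * σ
OnLine ∞       σ c = σ ≡ 0ℚ

_≐_ : Rel ℚ 0ℓ → Rel ℚ 0ℓ → Set
P ≐ Q = ∀ σ c → P σ c ⇔ Q σ c

Solvable-scale : ∀ {n} (M : Matrix n) {σ c} k → Solvable M σ c → Solvable M (k * σ) (k * c)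
Solvable-scale M {c = c} k (x , Mx≡c , Σx≡σ) =
  (λ j → k * x j) , M[kx]≡kc , trans (Σ-*ˡ k x) (cong (k *_) Σx≡σ)
  where
  M[kx]≡kc : M · (λ j → k * x j) ≡const (k * c)
  M[kx]≡kc i = begin
    Σ (λ j → M i j * (k * x j)) ≡⟨ Σ-cong (λ j → solve 3 (λ m k x → m :* (k :* x) := k :* (m :* x)) refl (M i j) k (x j)) ⟩
    Σ (λ j → k * (M i j * x j)) ≡⟨ Σ-*ˡ k (λ j → M i j * x j) ⟩
    k * Σ (λ j → M i j * x j)   ≡⟨ cong (k *_) (Mx≡c i) ⟩
    k * c                       ∎

bilinear : ∀ {n} → Matrix n → (Fin n → ℚ) → (Fin n → ℚ) → ℚ
bilinear M y x = Σ λ i → y i * Σ λ j → M i j * x j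

bilinear-const : ∀ {n} (M : Matrix n) {x c} y → M · x ≡const c → bilinear M y x ≡ c * Σ y
bilinear-const M {x} {c} y Mx≡c = begin
  Σ (λ i → y i * Σ (λ j → M i j * x j)) ≡⟨ Σ-cong (λ i → trans (cong (y i *_) (Mx≡c i)) (ℚP.*-comm (y i) c)) ⟩
  Σ (λ i → c * y i)                     ≡⟨ Σ-*ˡ c y ⟩
  c * Σ y                               ∎

bilinear-sym : ∀ {n} (M : Matrix n) → (∀ i j → M i j ≡ M j i) → ∀ y x → bilinear M y x ≡ bilinear M x y
bilinear-sym M M-sym y x = begin
  Σ (λ i → y i * Σ (λ j → M i j * x j))     ≡⟨ Σ-cong (λ i → Σ-*ˡ (y i) (λ j → M i j * x j)) ⟨
  Σ (λ i → Σ (λ j → y i * (M i j * x j)))   ≡⟨ Σ-comm (λ i j → y i * (M i j * x j)) ⟩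
  Σ (λ j → Σ (λ i → y i * (M i j * x j)))   ≡⟨ Σ-cong (λ j → Σ-cong (λ i → swap i j)) ⟩
  Σ (λ j → Σ (λ i → x j * (M j i * y i)))   ≡⟨ Σ-cong (λ j → Σ-*ˡ (x j) (λ i → M j i * y i)) ⟩
  Σ (λ j → x j * Σ (λ i → M j i * y i))     ∎
  where
  swap : ∀ i j → y i * (M i j * x j) ≡ x j * (M j i * y i)
  swap i j rewrite M-sym i j = solve 3 (λ y m x → y :* (m :* x) := x :* (m :* y)) refl (y i) (M j i) (x j)

Solvable-pairing : ∀ {n} (M : Matrix n) → (∀ i j → M i j ≡ M j i) →
  ∀ {σ₁ c₁ σ₂ c₂} → Solvable M σ₁ c₁ → Solvable M σ₂ c₂ → c₁ * σ₂ ≡ c₂ * σ₁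
Solvable-pairing M M-sym {c₁ = c₁} {c₂ = c₂} (x₁ , Mx₁ , refl) (x₂ , Mx₂ , refl) = begin
  c₁ * Σ x₂         ≡⟨ bilinear-const M x₂ Mx₁ ⟨
  bilinear M x₂ x₁  ≡⟨ bilinear-sym M M-sym x₂ x₁ ⟩
  bilinear M x₁ x₂  ≡⟨ bilinear-const M x₁ Mx₂ ⟩
  c₂ * Σ x₁         ∎

-- For symmetric M, pairing with a single solution pins down the whole line.
HasIndex⇒Solvable≐OnLine : ∀ {n} (M : Matrix n) → (∀ i j → M i j ≡ M j i) →
  ∀ {e} → HasIndex M e → Solvable M ≐ OnLine e
HasIndex⇒Solvable≐OnLine M M-sym {fin t} (_ , x₀) σ c = mk⇔ on-line scale-x₀
  where
  on-line : Solvable M σ c → c ≡ t * σ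
  on-line s = trans (sym (ℚP.*-identityʳ c)) (Solvable-pairing M M-sym s x₀)
  scale-x₀ : c ≡ t * σ → Solvable M σ c
  scale-x₀ refl = subst₂ (Solvable M) (ℚP.*-identityʳ σ) (ℚP.*-comm σ t) (Solvable-scale M σ x₀)
HasIndex⇒Solvable≐OnLine M M-sym {∞} ((z , Mz≡1) , Σ≡0) σ c = mk⇔ on-line scale-z
  where
  z₀ : Solvable M 0ℚ 1ℚ
  z₀ = z , Mz≡1 , Σ≡0 z Mz≡1
  on-line : Solvable M σ c → σ ≡ 0ℚ
  on-line s = begin
    σ       ≡⟨ ℚP.*-identityˡ σ ⟨
    1ℚ * σ  ≡⟨ Solvable-pairing M M-sym s z₀ ⟨
    c * 0ℚ  ≡⟨ ℚP.*-zeroʳ c ⟩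
    0ℚ      ∎
  scale-z : σ ≡ 0ℚ → Solvable M σ c
  scale-z refl = subst₂ (Solvable M) (ℚP.*-zeroʳ c) (ℚP.*-identityʳ c) (Solvable-scale M c z₀)

Solvable≐OnLine⇒HasIndex : ∀ {n} {M : Matrix n} e → Solvable M ≐ OnLine e → HasIndex M e
Solvable≐OnLine⇒HasIndex {M = M} (fin t) line = unique , solvable 1ℚ t (sym (ℚP.*-identityʳ t))
  where
  on-line = λ σ c → Equivalence.to (line σ c)
  solvable = λ σ c → Equivalence.from (line σ c)
  sum≢0 : ∀ {x} → M · x ≡const 1ℚ → Σ x ≢ 0ℚ
  sum≢0 {x} Mx≡1 Σx≡0 = 1≢0 (trans (on-line 0ℚ 1ℚ (x , Mx≡1 , Σx≡0)) (ℚP.*-zeroʳ t))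
  unique : ¬ ∃ (λ x → M · x ≡const 1ℚ) ⊎ ∃ (λ x → M · x ≡const 1ℚ × Σ x ≢ 0ℚ)
  unique with t ≟ 0ℚ
  ... | yes refl = inj₁ λ (x , Mx≡1) → 1≢0 (trans (on-line (Σ x) 1ℚ (x , Mx≡1 , refl)) (ℚP.*-zeroˡ (Σ x)))
  ... | no t≢0   =
    let x , Mx≡1 , _ = solvable (1/_ t {{≢-nonZero t≢0}}) 1ℚ (sym (ℚP.*-inverseʳ t {{≢-nonZero t≢0}}))
    in inj₂ (x , Mx≡1 , sum≢0 Mx≡1)
Solvable≐OnLine⇒HasIndex ∞ line =
  let z , Mz≡1 , _ = Equivalence.from (line 0ℚ 1ℚ) refl
  in (z , Mz≡1) , λ x Mx≡1 → Equivalence.to (line (Σ x) 1ℚ) (x , Mx≡1 , refl)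

Join : Rel ℚ 0ℓ → Rel ℚ 0ℓ → Rel ℚ 0ℓ
Join P Q σ c = ∃₂ λ Y W → Y + W ≡ σ × P Y (c - W) × Q W (c - Y)

Join-cong : ∀ {P P′ Q Q′ : Rel ℚ 0ℓ} → P ≐ P′ → Q ≐ Q′ → Join P Q ≐ Join P′ Q′
Join-cong P≐P′ Q≐Q′ σ c = mk⇔
  (λ (Y , W , Y+W≡σ , p , q) → Y , W , Y+W≡σ , to (P≐P′ Y (c - W)) p , to (Q≐Q′ W (c - Y)) q)
  (λ (Y , W , Y+W≡σ , p , q) → Y , W , Y+W≡σ , from (P≐P′ Y (c - W)) p , from (Q≐Q′ W (c - Y)) q)
  where open Equivalence

record IsJoinMatrix {p q} (M : Matrix (p ℕ.+ q)) (A : Matrix p) (B : Matrix q) : Set where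
  field
    ↑ˡ↑ˡ : ∀ i j → M (i ↑ˡ q) (j ↑ˡ q) ≡ A i j
    ↑ˡ↑ʳ : ∀ i j → M (i ↑ˡ q) (p ↑ʳ j) ≡ 1ℚ
    ↑ʳ↑ˡ : ∀ i j → M (p ↑ʳ i) (j ↑ˡ q) ≡ 1ℚ
    ↑ʳ↑ʳ : ∀ i j → M (p ↑ʳ i) (p ↑ʳ j) ≡ B i j

module _ {p q} {M : Matrix (p ℕ.+ q)} {A : Matrix p} {B : Matrix q} (M-join : IsJoinMatrix M A B) where
  open IsJoinMatrix M-join

  row-↑ˡ : ∀ (x : Fin (p ℕ.+ q) → ℚ) i → Σ (λ u → M (i ↑ˡ q) u * x u) ≡ Σ (λ j → A i j * x (j ↑ˡ q)) + Σ (λ j → x (p ↑ʳ j))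
  row-↑ˡ x i = trans (Σ-split p q (λ u → M (i ↑ˡ q) u * x u)) (cong₂ _+_
    (Σ-cong λ j → cong (_* x (j ↑ˡ q)) (↑ˡ↑ˡ i j))
    (Σ-cong λ j → trans (cong (_* x (p ↑ʳ j)) (↑ˡ↑ʳ i j)) (ℚP.*-identityˡ (x (p ↑ʳ j)))))

  row-↑ʳ : ∀ (x : Fin (p ℕ.+ q) → ℚ) i → Σ (λ u → M (p ↑ʳ i) u * x u) ≡ Σ (λ j → B i j * x (p ↑ʳ j)) + Σ (λ j → x (j ↑ˡ q))
  row-↑ʳ x i = trans (Σ-split p q (λ u → M (p ↑ʳ i) u * x u)) (trans (cong₂ _+_
    (Σ-cong λ j → trans (cong (_* x (j ↑ˡ q)) (↑ʳ↑ˡ i j)) (ℚP.*-identityˡ (x (j ↑ˡ q))))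
    (Σ-cong λ j → cong (_* x (p ↑ʳ j)) (↑ʳ↑ʳ i j)))
    (ℚP.+-comm (Σ (λ j → x (j ↑ˡ q))) (Σ (λ j → B i j * x (p ↑ʳ j)))))

  Solvable-join : Solvable M ≐ Join (Solvable A) (Solvable B)
  Solvable-join σ c = mk⇔ split glue
    where
    split : Solvable M σ c → Join (Solvable A) (Solvable B) σ c
    split (x , Mx≡c , refl) =
      Σ y , Σ w , sym (Σ-split p q x) ,
      (y , (λ i → p+q≡r⇒p≡r-q (trans (sym (row-↑ˡ x i)) (Mx≡c (i ↑ˡ q)))) , refl) ,
      (w , (λ j → p+q≡r⇒p≡r-q (trans (sym (row-↑ʳ x j)) (Mx≡c (p ↑ʳ j)))) , refl)
      where
      y = λ i → x (i ↑ˡ q)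
      w = λ j → x (p ↑ʳ j)
    glue : Join (Solvable A) (Solvable B) σ c → Solvable M σ c
    glue (_ , _ , refl , (y , Ay≡c-Σw , refl) , (w , Bw≡c-Σy , refl)) =
      y ++ w ,
      ↑ˡ-↑ʳ-elim (λ u → Σ (λ v → M u v * (y ++ w) v) ≡ c) row-↑ˡ≡c row-↑ʳ≡c ,
      trans (Σ-split p q (y ++ w)) (cong₂ _+_ Σy Σw)
      where
      Σy : Σ (λ i → (y ++ w) (i ↑ˡ q)) ≡ Σ y
      Σy = Σ-cong (lookup-++ˡ y w)
      Σw : Σ (λ j → (y ++ w) (p ↑ʳ j)) ≡ Σ w
      Σw = Σ-cong (lookup-++ʳ y w)
      row-↑ˡ≡c : ∀ i → Σ (λ u → M (i ↑ˡ q) u * (y ++ w) u) ≡ c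
      row-↑ˡ≡c i = begin
        Σ (λ u → M (i ↑ˡ q) u * (y ++ w) u)
          ≡⟨ row-↑ˡ (y ++ w) i ⟩
        Σ (λ j → A i j * (y ++ w) (j ↑ˡ q)) + Σ (λ j → (y ++ w) (p ↑ʳ j))
          ≡⟨ cong₂ _+_ (Σ-cong λ j → cong (A i j *_) (lookup-++ˡ y w j)) Σw ⟩
        Σ (λ j → A i j * y j) + Σ w
          ≡⟨ cong (_+ Σ w) (Ay≡c-Σw i) ⟩
        (c - Σ w) + Σ w
          ≡⟨ p-q+q≡p c (Σ w) ⟩
        c ∎
      row-↑ʳ≡c : ∀ j → Σ (λ u → M (p ↑ʳ j) u * (y ++ w) u) ≡ c
      row-↑ʳ≡c j = begin
        Σ (λ u → M (p ↑ʳ j) u * (y ++ w) u)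
          ≡⟨ row-↑ʳ (y ++ w) j ⟩
        Σ (λ i → B j i * (y ++ w) (p ↑ʳ i)) + Σ (λ i → (y ++ w) (i ↑ˡ q))
          ≡⟨ cong₂ _+_ (Σ-cong λ i → cong (B j i *_) (lookup-++ʳ y w i)) Σy ⟩
        Σ (λ i → B j i * w i) + Σ y
          ≡⟨ cong (_+ Σ y) (Bw≡c-Σy j) ⟩
        (c - Σ y) + Σ y
          ≡⟨ p-q+q≡p c (Σ y) ⟩
        c ∎

regular-elimination : ∀ α β Y W c → c - W ≡ α * Y → c - Y ≡ β * W →
  c * (α + β - toℚ 2) ≡ (α * β - 1ℚ) * (Y + W)
regular-elimination α β Y W c c-W≡αY c-Y≡βW = begin
  c * (α + β - toℚ 2)
    ≡⟨ solve 5 (λ α β Y W c → c :* (α :+ β :- con (toℚ 2)) :=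
         (α :* β :- con 1ℚ) :* (Y :+ W) :+ (β :- con 1ℚ) :* ((c :- W) :- α :* Y) :+ (α :- con 1ℚ) :* ((c :- Y) :- β :* W))
         refl α β Y W c ⟩
  (α * β - 1ℚ) * (Y + W) + (β - 1ℚ) * ((c - W) - α * Y) + (α - 1ℚ) * ((c - Y) - β * W)
    ≡⟨ cong₂ (λ u v → (α * β - 1ℚ) * (Y + W) + (β - 1ℚ) * u + (α - 1ℚ) * v) (p≡q⇒p-q≡0 c-W≡αY) (p≡q⇒p-q≡0 c-Y≡βW) ⟩
  (α * β - 1ℚ) * (Y + W) + (β - 1ℚ) * 0ℚ + (α - 1ℚ) * 0ℚ
    ≡⟨ solve 4 (λ α β Y W → (α :* β :- con 1ℚ) :* (Y :+ W) :+ (β :- con 1ℚ) :* con 0ℚ :+ (α :- con 1ℚ) :* con 0ℚ :=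
         (α :* β :- con 1ℚ) :* (Y :+ W)) refl α β Y W ⟩
  (α * β - 1ℚ) * (Y + W)
    ∎

singular-elimination : ∀ α β Y W c → c - W ≡ α * Y → c - Y ≡ β * W → α + β - toℚ 2 ≡ 0ℚ →
  (Y + W) * (α - 1ℚ) ≡ 0ℚ
singular-elimination α β Y W c c-W≡αY c-Y≡βW s≡0 = begin
  (Y + W) * (α - 1ℚ)
    ≡⟨ solve 5 (λ α β Y W c → (Y :+ W) :* (α :- con 1ℚ) :=
         ((c :- Y) :- β :* W) :- ((c :- W) :- α :* Y) :+ (α :+ β :- con (toℚ 2)) :* W) refl α β Y W c ⟩
  ((c - Y) - β * W) - ((c - W) - α * Y) + (α + β - toℚ 2) * W
    ≡⟨ cong₂ (λ u v → v - u + (α + β - toℚ 2) * W) (p≡q⇒p-q≡0 c-W≡αY) (p≡q⇒p-q≡0 c-Y≡βW) ⟩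
  0ℚ - 0ℚ + (α + β - toℚ 2) * W
    ≡⟨ cong (λ s → 0ℚ - 0ℚ + s * W) s≡0 ⟩
  0ℚ - 0ℚ + 0ℚ * W
    ≡⟨ solve 1 (λ W → con 0ℚ :- con 0ℚ :+ con 0ℚ :* W := con 0ℚ) refl W ⟩
  0ℚ
    ∎

OnLine-regular : ∀ α β .{{_ : NonZero (α + β - toℚ 2)}} →
  OnLine (fin ((α * β - 1ℚ) ÷ (α + β - toℚ 2))) ≐ Join (OnLine (fin α)) (OnLine (fin β))
OnLine-regular α β σ c = mk⇔ split merge
  where
  s = α + β - toℚ 2
  r = 1/ s
  split : c ≡ (α * β - 1ℚ) * r * σ → Join (OnLine (fin α)) (OnLine (fin β)) σ c
  split refl = (β - 1ℚ) * r * σ , (α - 1ℚ) * r * σ , Y+W≡σ ,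
    solve 4 (λ α β r σ → (α :* β :- con 1ℚ) :* r :* σ :- (α :- con 1ℚ) :* r :* σ := α :* ((β :- con 1ℚ) :* r :* σ)) refl α β r σ ,
    solve 4 (λ α β r σ → (α :* β :- con 1ℚ) :* r :* σ :- (β :- con 1ℚ) :* r :* σ := β :* ((α :- con 1ℚ) :* r :* σ)) refl α β r σ
    where
    Y+W≡σ : (β - 1ℚ) * r * σ + (α - 1ℚ) * r * σ ≡ σ
    Y+W≡σ = begin
      (β - 1ℚ) * r * σ + (α - 1ℚ) * r * σ
        ≡⟨ solve 4 (λ α β r σ → (β :- con 1ℚ) :* r :* σ :+ (α :- con 1ℚ) :* r :* σ := (α :+ β :- con (toℚ 2)) :* r :* σ) refl α β r σ ⟩
      s * r * σ  ≡⟨ cong (_* σ) (ℚP.*-inverseʳ s) ⟩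
      1ℚ * σ     ≡⟨ ℚP.*-identityˡ σ ⟩
      σ          ∎
  merge : Join (OnLine (fin α)) (OnLine (fin β)) σ c → c ≡ (α * β - 1ℚ) * r * σ
  merge (Y , W , refl , c-W≡αY , c-Y≡βW) = begin
    c                             ≡⟨ p*q≡r⇒p≡r÷q s (regular-elimination α β Y W c c-W≡αY c-Y≡βW) ⟩
    ((α * β - 1ℚ) * (Y + W)) * r  ≡⟨ solve 3 (λ k σ r → (k :* σ) :* r := (k :* r) :* σ) refl (α * β - 1ℚ) (Y + W) r ⟩
    ((α * β - 1ℚ) * r) * (Y + W)  ∎

OnLine-singular : ∀ α β → α + β - toℚ 2 ≡ 0ℚ → α ≢ 1ℚ → OnLine ∞ ≐ Join (OnLine (fin α)) (OnLine (fin β))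
OnLine-singular α β s≡0 α≢1 σ c = mk⇔ split merge
  where
  instance
    α-1-nonZero : NonZero (α - 1ℚ)
    α-1-nonZero = ≢-nonZero (α≢1 ∘ p-q≡0⇒p≡q)
  witness : ∀ Y → (α - 1ℚ) * Y ≡ c → Join (OnLine (fin α)) (OnLine (fin β)) 0ℚ c
  witness Y refl = Y , - Y , ℚP.+-inverseʳ Y ,
    solve 2 (λ α Y → (α :- con 1ℚ) :* Y :- (:- Y) := α :* Y) refl α Y ,
    (begin
      (α - 1ℚ) * Y - Y               ≡⟨ solve 3 (λ α β Y → (α :- con 1ℚ) :* Y :- Y := β :* (:- Y) :+ (α :+ β :- con (toℚ 2)) :* Y) refl α β Y ⟩
      β * - Y + (α + β - toℚ 2) * Y  ≡⟨ cong (λ s → β * - Y + s * Y) s≡0 ⟩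
      β * - Y + 0ℚ * Y               ≡⟨ solve 2 (λ β Y → β :* (:- Y) :+ con 0ℚ :* Y := β :* (:- Y)) refl β Y ⟩
      β * - Y                        ∎)
  split : σ ≡ 0ℚ → Join (OnLine (fin α)) (OnLine (fin β)) σ c
  split refl = witness (c ÷ (α - 1ℚ)) (q*[p÷q]≡p c (α - 1ℚ))
  merge : Join (OnLine (fin α)) (OnLine (fin β)) σ c → σ ≡ 0ℚ
  merge (Y , W , refl , c-W≡αY , c-Y≡βW) =
    trans (p*q≡r⇒p≡r÷q (α - 1ℚ) (singular-elimination α β Y W c c-W≡αY c-Y≡βW s≡0)) (ℚP.*-zeroˡ (1/ (α - 1ℚ)))

OnLine-unit : OnLine (fin 1ℚ) ≐ Join (OnLine (fin 1ℚ)) (OnLine (fin 1ℚ))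
OnLine-unit σ c = mk⇔ split merge
  where
  split : c ≡ 1ℚ * σ → Join (OnLine (fin 1ℚ)) (OnLine (fin 1ℚ)) σ c
  split refl = σ , 0ℚ , ℚP.+-identityʳ σ ,
    solve 1 (λ σ → con 1ℚ :* σ :- con 0ℚ := con 1ℚ :* σ) refl σ ,
    solve 1 (λ σ → con 1ℚ :* σ :- σ := con 1ℚ :* con 0ℚ) refl σ
  merge : Join (OnLine (fin 1ℚ)) (OnLine (fin 1ℚ)) σ c → c ≡ 1ℚ * σ
  merge (Y , W , refl , c-W≡Y , _) = begin
    c            ≡⟨ p-q+q≡p c W ⟨
    (c - W) + W  ≡⟨ cong (_+ W) c-W≡Y ⟩
    1ℚ * Y + W   ≡⟨ solve 2 (λ Y W → con 1ℚ :* Y :+ W := con 1ℚ :* (Y :+ W)) refl Y W ⟩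
    1ℚ * (Y + W) ∎

OnLine-∞-fin : ∀ β → OnLine (fin β) ≐ Join (OnLine ∞) (OnLine (fin β))
OnLine-∞-fin β σ c = mk⇔ split merge
  where
  split : c ≡ β * σ → Join (OnLine ∞) (OnLine (fin β)) σ c
  split refl = 0ℚ , σ , ℚP.+-identityˡ σ , refl , ℚP.+-identityʳ (β * σ)
  merge : Join (OnLine ∞) (OnLine (fin β)) σ c → c ≡ β * σ
  merge (_ , W , refl , refl , c-0≡βW) =
    trans (sym (ℚP.+-identityʳ c)) (trans c-0≡βW (cong (β *_) (sym (ℚP.+-identityˡ W))))

OnLine-fin-∞ : ∀ α → OnLine (fin α) ≐ Join (OnLine (fin α)) (OnLine ∞)
OnLine-fin-∞ α σ c = mk⇔ split merge
  where
  split : c ≡ α * σ → Join (OnLine (fin α)) (OnLine ∞) σ c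
  split refl = σ , 0ℚ , ℚP.+-identityʳ σ , ℚP.+-identityʳ (α * σ) , refl
  merge : Join (OnLine (fin α)) (OnLine ∞) σ c → c ≡ α * σ
  merge (Y , _ , refl , c-0≡αY , refl) =
    trans (sym (ℚP.+-identityʳ c)) (trans c-0≡αY (cong (α *_) (sym (ℚP.+-identityʳ Y))))

OnLine-∞-∞ : OnLine ∞ ≐ Join (OnLine ∞) (OnLine ∞)
OnLine-∞-∞ σ c = mk⇔ split merge
  where
  split : σ ≡ 0ℚ → Join (OnLine ∞) (OnLine ∞) σ c
  split refl = 0ℚ , 0ℚ , refl , refl , refl
  merge : Join (OnLine ∞) (OnLine ∞) σ c → σ ≡ 0ℚ
  merge (_ , _ , refl , refl , refl) = refl

OnLine-finCase : ∀ α β → OnLine (finCase α β) ≐ Join (OnLine (fin α)) (OnLine (fin β))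
OnLine-finCase α β with (α + β - toℚ 2) ≟ 0ℚ
... | no s≢0 = OnLine-regular α β {{≢-nonZero s≢0}}
... | yes s≡0 with α ≟ 1ℚ | β ≟ 1ℚ
...   | yes refl | yes refl = OnLine-unit
...   | yes refl | no β≢1   = ⊥-elim (β≢1 (p-q≡0⇒p≡q (trans (solve 1 (λ β → β :- con 1ℚ := con 1ℚ :+ β :- con (toℚ 2)) refl β) s≡0)))
...   | no α≢1   | _        = OnLine-singular α β s≡0 α≢1

OnLine-joinFormula : ∀ a b → OnLine (joinFormula a b) ≐ Join (OnLine a) (OnLine b)
OnLine-joinFormula (fin α) (fin β) = OnLine-finCase α β
OnLine-joinFormula ∞       (fin β) = OnLine-∞-fin β
OnLine-joinFormula (fin α) ∞       = OnLine-fin-∞ α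
OnLine-joinFormula ∞       ∞       = OnLine-∞-∞

Solvable-joinFormula : ∀ {p q} {M : Matrix (p ℕ.+ q)} {A : Matrix p} {B : Matrix q} → IsJoinMatrix M A B →
  ∀ {a b} → Solvable A ≐ OnLine a → Solvable B ≐ OnLine b → Solvable M ≐ OnLine (joinFormula a b)
Solvable-joinFormula M-join {a} {b} A-line B-line σ c =
  ⇔-sym (OnLine-joinFormula a b σ c) ⇔-∘ (Join-cong A-line B-line σ c ⇔-∘ Solvable-join M-join σ c)

search-none : ∀ (p : ℕ → Bool) b → (∀ j → j < b → p j ≡ false) → search p b ≡ nothing
search-none p zero    _      = refl
search-none p (suc b) p≡false
  rewrite search-none p b (λ j j<b → p≡false j (ℕP.m<n⇒m<1+n j<b)) | p≡false b ℕP.≤-refl = refl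

search-first : ∀ (p : ℕ → Bool) b k → k < b → p k ≡ true → (∀ j → j < k → p j ≡ false) → search p b ≡ just k
search-first p (suc b) k (s≤s k≤b) pk below with ℕP.m≤n⇒m<n∨m≡n k≤b
... | inj₁ k<b  rewrite search-first p b k k<b pk below = refl
... | inj₂ refl rewrite search-none p k below | pk = refl

search-sound : ∀ (p : ℕ → Bool) b {k} → search p b ≡ just k → p k ≡ true
search-sound p (suc b) found with search p b in earlier
search-sound p (suc b) refl | just k = search-sound p b earlier
... | nothing with p b in pb
search-sound p (suc b) refl | nothing | true = pb

distinct⇒1< : ∀ {N} {u v : Fin N} → u ≢ v → 1 < N
distinct⇒1< {suc zero}    {zero} {zero} u≢v = ⊥-elim (u≢v refl)
distinct⇒1< {suc (suc N)} _                 = s≤s (s≤s z≤n)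

distinct₃⇒2< : ∀ {N} {u v w : Fin N} → u ≢ v → u ≢ w → v ≢ w → 2 < N
distinct₃⇒2< {suc N} u≢v u≢w v≢w = s≤s (distinct⇒1< (v≢w ∘ punchOut-injective u≢v u≢w))

anyFin-true : ∀ {N} (p : Fin N → Bool) w → p w ≡ true → anyFin p ≡ true
anyFin-true p zero    pw rewrite pw = refl
anyFin-true p (suc w) pw = trans (cong (p zero ∨_) (anyFin-true (p ∘ suc) w pw)) (∨-zeroʳ (p zero))

anyFin-false : ∀ {N} (p : Fin N → Bool) → (∀ w → p w ≡ false) → anyFin p ≡ false
anyFin-false {zero}  p _     = refl
anyFin-false {suc N} p p≡false rewrite p≡false zero = anyFin-false (p ∘ suc) (p≡false ∘ suc)

module _ {N} (G : Graph N) where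

  adj⇒≢ : ∀ {u v} → adj G u v ≡ true → u ≢ v
  adj⇒≢ {u} uv refl with () ← trans (sym uv) (irrefl G u)

  reach-1-adj : ∀ {u v} → adj G u v ≡ true → reach G 1 u v ≡ true
  reach-1-adj {u} {v} uv = trans (cong (does (u Fin.≟ v) ∨_) (anyFin-true _ u via-u)) (∨-zeroʳ _)
    where
    via-u : does (u Fin.≟ u) ∧ adj G u v ≡ true
    via-u rewrite dec-true (u Fin.≟ u) refl = uv

  reach-1-nonadj : ∀ {u v} → u ≢ v → adj G u v ≡ false → reach G 1 u v ≡ false
  reach-1-nonadj {u} {v} u≢v ¬uv rewrite dec-false (u Fin.≟ v) u≢v = anyFin-false _ not-via
    where
    not-via : ∀ w → does (u Fin.≟ w) ∧ adj G w v ≡ false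
    not-via w with u Fin.≟ w
    ... | yes refl = ¬uv
    ... | no _     = refl

  reach-2-common : ∀ {u v} w → adj G u w ≡ true → adj G w v ≡ true → reach G 2 u v ≡ true
  reach-2-common {u} {v} w uw wv = trans (cong (reach G 1 u v ∨_) (anyFin-true _ w via-w)) (∨-zeroʳ _)
    where
    via-w : reach G 1 u w ∧ adj G w v ≡ true
    via-w rewrite reach-1-adj uw = wv

  dist-refl : ∀ u → dist G u u ≡ just 0
  dist-refl u = search-first _ N 0 (ℕP.≤-<-trans z≤n (toℕ<n u)) (dec-true (u Fin.≟ u) refl) (λ _ ())

  dist-adj : ∀ {u v} → adj G u v ≡ true → dist G u v ≡ just 1
  dist-adj {u} {v} uv = search-first _ N 1 (distinct⇒1< (adj⇒≢ uv)) (reach-1-adj uv)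
    λ { zero _ → dec-false (u Fin.≟ v) (adj⇒≢ uv) ; (suc _) (s≤s ()) }

  dist-common : ∀ {u v} w → u ≢ v → adj G u v ≡ false → adj G u w ≡ true → adj G w v ≡ true → dist G u v ≡ just 2
  dist-common {u} {v} w u≢v ¬uv uw wv =
    search-first _ N 2 (distinct₃⇒2< u≢v (adj⇒≢ uw) (adj⇒≢ wv ∘ sym)) (reach-2-common w uw wv)
    λ { zero _ → dec-false (u Fin.≟ v) u≢v ; (suc zero) _ → reach-1-nonadj u≢v ¬uv ; (suc (suc _)) (s≤s (s≤s ())) }

  D-refl : ∀ u → D G u u ≡ 0ℚ
  D-refl u = cong (maybe toℚ 0ℚ) (dist-refl u)

  D̃-refl : ∀ u → D̃ G u u ≡ 0ℚ
  D̃-refl u = cong (maybe (λ k → toℚ (k ⊓ 2)) (toℚ 2)) (dist-refl u)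

  D-adj : ∀ {u v} → adj G u v ≡ true → D G u v ≡ 1ℚ
  D-adj uv = cong (maybe toℚ 0ℚ) (dist-adj uv)

  D̃-adj : ∀ {u v} → adj G u v ≡ true → D̃ G u v ≡ 1ℚ
  D̃-adj uv = cong (maybe (λ k → toℚ (k ⊓ 2)) (toℚ 2)) (dist-adj uv)

  D-common : ∀ {u v} w → u ≢ v → adj G u v ≡ false → adj G u w ≡ true → adj G w v ≡ true → D G u v ≡ toℚ 2
  D-common w u≢v ¬uv uw wv = cong (maybe toℚ 0ℚ) (dist-common w u≢v ¬uv uw wv)

  D̃-nonadj : ∀ {u v} → u ≢ v → adj G u v ≡ false → D̃ G u v ≡ toℚ 2
  D̃-nonadj {u} {v} u≢v ¬uv with dist G u v in d≡k
  ... | nothing = refl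
  ... | just k  = cong toℚ (k⊓2≡2 k (search-sound _ N d≡k))
    where
    k⊓2≡2 : ∀ k → reach G k u v ≡ true → k ⊓ 2 ≡ 2
    k⊓2≡2 zero          r with () ← trans (sym r) (dec-false (u Fin.≟ v) u≢v)
    k⊓2≡2 (suc zero)    r with () ← trans (sym r) (reach-1-nonadj u≢v ¬uv)
    k⊓2≡2 (suc (suc k)) _ = ℕP.m≥n⇒m⊓n≡n (s≤s (s≤s z≤n))

  D̃-sym : ∀ u v → D̃ G u v ≡ D̃ G v u
  D̃-sym u v with u Fin.≟ v | adj G u v in uv
  ... | yes refl | _     = refl
  ... | no u≢v   | true  = trans (D̃-adj uv) (sym (D̃-adj (trans (adjSym G v u) uv)))
  ... | no u≢v   | false = trans (D̃-nonadj u≢v uv) (sym (D̃-nonadj (u≢v ∘ sym) (trans (adjSym G v u) uv)))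

-- w plays the role of the cone vertex of G + K₁ in the definition of D̃.
D-dominated≡D̃ : ∀ {N N′} {G : Graph N} {K : Graph N′} (f : Fin N → Fin N′) → Injective _≡_ _≡_ f →
  (∀ u v → adj K (f u) (f v) ≡ adj G u v) → ∀ w → (∀ u → adj K (f u) w ≡ true) →
  ∀ u v → D K (f u) (f v) ≡ D̃ G u v
D-dominated≡D̃ {G = G} {K} f f-inj f-adj w w-adj u v with u Fin.≟ v | adj G u v in uv
... | yes refl | _     = trans (D-refl K (f u)) (sym (D̃-refl G u))
... | no u≢v   | true  = trans (D-adj K (trans (f-adj u v) uv)) (sym (D̃-adj G uv))
... | no u≢v   | false = trans
  (D-common K w (u≢v ∘ f-inj) (trans (f-adj u v) uv) (w-adj u) (trans (adjSym K w (f v)) (w-adj v)))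
  (sym (D̃-nonadj G u≢v uv))

module _ {n m} (G : Graph (suc n)) (H : Graph (suc m)) where

  adj-↑ˡ↑ˡ : ∀ i j → adj (G ⊹ H) (i ↑ˡ suc m) (j ↑ˡ suc m) ≡ adj G i j
  adj-↑ˡ↑ˡ i j rewrite splitAt-↑ˡ (suc n) i (suc m) | splitAt-↑ˡ (suc n) j (suc m) = refl

  adj-↑ˡ↑ʳ : ∀ i j → adj (G ⊹ H) (i ↑ˡ suc m) (suc n ↑ʳ j) ≡ true
  adj-↑ˡ↑ʳ i j rewrite splitAt-↑ˡ (suc n) i (suc m) | splitAt-↑ʳ (suc n) (suc m) j = refl

  adj-↑ʳ↑ˡ : ∀ i j → adj (G ⊹ H) (suc n ↑ʳ i) (j ↑ˡ suc m) ≡ true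
  adj-↑ʳ↑ˡ i j rewrite splitAt-↑ʳ (suc n) (suc m) i | splitAt-↑ˡ (suc n) j (suc m) = refl

  adj-↑ʳ↑ʳ : ∀ i j → adj (G ⊹ H) (suc n ↑ʳ i) (suc n ↑ʳ j) ≡ adj H i j
  adj-↑ʳ↑ʳ i j rewrite splitAt-↑ʳ (suc n) (suc m) i | splitAt-↑ʳ (suc n) (suc m) j = refl

  D-join : IsJoinMatrix (D (G ⊹ H)) (D̃ G) (D̃ H)
  D-join = record
    { ↑ˡ↑ˡ = D-dominated≡D̃ (_↑ˡ suc m) (↑ˡ-injective (suc m) _ _) adj-↑ˡ↑ˡ (suc n ↑ʳ zero) (λ i → adj-↑ˡ↑ʳ i zero)
    ; ↑ˡ↑ʳ = λ i j → D-adj (G ⊹ H) (adj-↑ˡ↑ʳ i j)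
    ; ↑ʳ↑ˡ = λ i j → D-adj (G ⊹ H) (adj-↑ʳ↑ˡ i j)
    ; ↑ʳ↑ʳ = D-dominated≡D̃ (suc n ↑ʳ_) (↑ʳ-injective (suc n) _ _) adj-↑ʳ↑ʳ (zero ↑ˡ suc m) (λ j → adj-↑ʳ↑ˡ j zero)
    }

theorem3p7 : ∀ {n m : ℕ} (G : Graph (suc n)) (H : Graph (suc m)) (a b : Ext) →
    ι̃Is G a → ι̃Is H b → ιIs (G ⊹ H) (joinFormula a b)
theorem3p7 G H a b ι̃G≡a ι̃H≡b =
  Solvable≐OnLine⇒HasIndex (joinFormula a b)
    (Solvable-joinFormula (D-join G H)
      (HasIndex⇒Solvable≐OnLine (D̃ G) (D̃-sym G) ι̃G≡a)
      (HasIndex⇒Solvable≐OnLine (D̃ H) (D̃-sym H) ι̃H≡b))
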